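{- Let $F$ be a field of characteristic $p>0$, $\lambda\ge 0$ an integer, and $A_1,\dots,A_n$ $\lambda$-Vandermonde finite subsets of $F$ such that $p$ divides each of $|A_1|,\dots,|A_n|$. Let $f\in F[X_1,\dots,X_n]$ be a polynomial with $\deg(f)<n(\lambda+1)$. Then \[\sum_{a\in A_1\times\dots\times A_n}f(a)=0.\]
   Context: A finite non-empty subset $A\subseteq F$ is $\lambda$-Vandermonde (for $\lambda\in\{0,\dots,|A|\}$) if $\sum_{a\in A}a^r=0$ for all $1\le r\le\lambda$. $\deg(f)$ is the total degree. -}

module Defs where

open import Level using (Level; _⊔_)
open import Algebra.Bundles using (CommutativeRing)
open import Data.Nat as ℕ using (ℕ; zero; suc)
open import Data.Fin using (Fin; zero; suc)
open import Data.List using (List; []; _∷_; map; length)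
open import Data.List.Relation.Unary.All using (All)
open import Data.Product using (Σ; _×_; _,_; proj₁; proj₂)
open import Relation.Nullary using (¬_)
import Data.List.Relation.Unary.Unique.Setoid as UniqueS
open import Data.Vec.Functional using (Vector; tail) renaming (_∷_ to _∷ᵥ_)

record Field (c ℓ : Level) : Set (Level.suc (c ⊔ ℓ)) where
  field
    commutativeRing : CommutativeRing c ℓ
  open CommutativeRing commutativeRing public
  field
    1≉0     : ¬ (1# ≈ 0#)
    inverse : ∀ x → ¬ (x ≈ 0#) → Σ Carrier (λ y → (x * y) ≈ 1#)

module FieldNotions {c ℓ : Level} (F : Field c ℓ) where
  open Field F public using (Carrier; _≈_; 0#; 1#)
  open Field F using (_+_; _*_; setoid)

  fromℕ : ℕ → Carrier
  fromℕ zero    = 0#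
  fromℕ (suc n) = 1# + fromℕ n

  HasCharacteristic : ℕ → Set ℓ
  HasCharacteristic p =
    (0 ℕ.< p) × (fromℕ p ≈ 0#) × (∀ m → 0 ℕ.< m → m ℕ.< p → ¬ (fromℕ m ≈ 0#))

  _^_ : Carrier → ℕ → Carrier
  x ^ zero  = 1#
  x ^ suc r = x * (x ^ r)

  sumL : List Carrier → Carrier
  sumL []       = 0#
  sumL (x ∷ xs) = x + sumL xs

  prodF : ∀ {n} → (Fin n → Carrier) → Carrier
  prodF {zero}  g = 1#
  prodF {suc n} g = g zero * prodF (λ i → g (suc i))

  -- A finite non-empty subset of F, given as a duplicate-free non-empty list.
  -- Its cardinality |A| is the length of the list.
  IsFiniteNonemptySubset : List Carrier → Set (c ⊔ ℓ)
  IsFiniteNonemptySubset A = UniqueS.Unique setoid A × (1 ℕ.≤ length A)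

  powerSum : List Carrier → ℕ → Carrier
  powerSum A r = sumL (map (λ a → a ^ r) A)

  IsVandermonde : ℕ → List Carrier → Set ℓ
  IsVandermonde λ' A =
    (λ' ℕ.≤ length A) × (∀ r → 1 ℕ.≤ r → r ℕ.≤ λ' → powerSum A r ≈ 0#)

  -- Polynomials in F[X_1,…,X_n]: finite lists of terms (coefficient, exponent vector)
  Term : ℕ → Set c
  Term n = Carrier × (Fin n → ℕ)

  Poly : ℕ → Set c
  Poly n = List (Term n)

  monoDeg : ∀ {n} → (Fin n → ℕ) → ℕ
  monoDeg {zero}  e = 0
  monoDeg {suc n} e = e zero ℕ.+ monoDeg (λ i → e (suc i))

  -- deg(f) < d : every term of f has total degree < d
  -- (the zero polynomial, deg = -∞, satisfies this for every d)
  DegLt : ∀ {n} → Poly n → ℕ → Set c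
  DegLt f d = All (λ t → monoDeg (proj₂ t) ℕ.< d) f

  evalTerm : ∀ {n} → Term n → (Fin n → Carrier) → Carrier
  evalTerm (k , e) x = k * prodF (λ i → x i ^ e i)

  eval : ∀ {n} → Poly n → (Fin n → Carrier) → Carrier
  eval f x = sumL (map (λ t → evalTerm t x) f)

  sumProd : ∀ {n} → (Fin n → List Carrier) → (Vector Carrier n → Carrier) → Carrier
  sumProd {zero}  A g = g (λ ())
  sumProd {suc n} A g = sumL (map (λ a → sumProd (tail A) (λ v → g (a ∷ᵥ v))) (A zero))

module Submission where

open import Defs
open import Level using (Level)
open import Data.Nat.Divisibility using (_∣_; divides)
open import Data.Fin using (Fin; zero; suc)
open import Data.List using (List; []; _∷_; map; length)
open import Data.List.Relation.Unary.All as All using (All; []; _∷_)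
open import Data.Product using (∃; _,_; proj₂)
open import Data.Vec.Functional using (Vector; tail) renaming (_∷_ to _∷ᵥ_)
open import Relation.Nullary using (yes; no)
import Relation.Binary.PropositionalEquality as ≡
open import Algebra.Properties.CommutativeSemigroup using (interchange)
import Data.Nat as ℕ
import Data.Nat.Properties as ℕ
import Relation.Binary.Reasoning.Setoid as SetoidReasoning

-- Summing a monomial X^e over the box A₁ × … × Aₙ factors as the
-- product of the power sums Σ_{a ∈ Aᵢ} a^{eᵢ}. If deg X^e < n(λ+1), some
-- exponent eᵢ is at most λ; that power sum vanishes, by the Vandermonde
-- condition when eᵢ ≥ 1 and because it equals |Aᵢ|·1 = 0 when eᵢ = 0.

module BoxSums {c ℓ : Level} (F : Field c ℓ) where
  open Field F hiding (zero; Carrier; _≈_; 0#; 1#)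
  open FieldNotions F
  open SetoidReasoning setoid

  sumL-cong : ∀ {a} {X : Set a} (xs : List X) {g h : X → Carrier} →
              (∀ x → g x ≈ h x) → sumL (map g xs) ≈ sumL (map h xs)
  sumL-cong []       g≈h = refl
  sumL-cong (x ∷ xs) g≈h = +-cong (g≈h x) (sumL-cong xs g≈h)

  sumL-+ : ∀ {a} {X : Set a} (xs : List X) (g h : X → Carrier) →
           sumL (map (λ x → g x + h x) xs) ≈ sumL (map g xs) + sumL (map h xs)
  sumL-+ []       g h = sym (+-identityˡ 0#)
  sumL-+ (x ∷ xs) g h = begin
    (g x + h x) + sumL (map (λ y → g y + h y) xs)       ≈⟨ +-cong refl (sumL-+ xs g h) ⟩
    (g x + h x) + (sumL (map g xs) + sumL (map h xs))   ≈⟨ interchange +-commutativeSemigroup _ _ _ _ ⟩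
    (g x + sumL (map g xs)) + (h x + sumL (map h xs))   ∎

  sumL-*ˡ : ∀ {a} {X : Set a} (xs : List X) (k : Carrier) (g : X → Carrier) →
            sumL (map (λ x → k * g x) xs) ≈ k * sumL (map g xs)
  sumL-*ˡ []       k g = sym (zeroʳ k)
  sumL-*ˡ (x ∷ xs) k g = trans (+-cong refl (sumL-*ˡ xs k g)) (sym (distribˡ k _ _))

  sumL-*ʳ : ∀ {a} {X : Set a} (xs : List X) (k : Carrier) (g : X → Carrier) →
            sumL (map (λ x → g x * k) xs) ≈ sumL (map g xs) * k
  sumL-*ʳ []       k g = sym (zeroˡ k)
  sumL-*ʳ (x ∷ xs) k g = trans (+-cong refl (sumL-*ʳ xs k g)) (sym (distribʳ k _ _))

  sumL-all≈0 : ∀ {a} {X : Set a} {g : X → Carrier} (xs : List X) →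
               All (λ x → g x ≈ 0#) xs → sumL (map g xs) ≈ 0#
  sumL-all≈0 []       []           = refl
  sumL-all≈0 (x ∷ xs) (gx≈0 ∷ all) = trans (+-cong gx≈0 (sumL-all≈0 xs all)) (+-identityˡ 0#)

  sumProd-cong : ∀ {n} (A : Fin n → List Carrier) {g h : Vector Carrier n → Carrier} →
                 (∀ v → g v ≈ h v) → sumProd A g ≈ sumProd A h
  sumProd-cong {ℕ.zero}  A g≈h = g≈h _
  sumProd-cong {ℕ.suc n} A g≈h =
    sumL-cong (A zero) (λ a → sumProd-cong (tail A) (λ v → g≈h (a ∷ᵥ v)))

  sumProd-0 : ∀ {n} (A : Fin n → List Carrier) → sumProd A (λ _ → 0#) ≈ 0#
  sumProd-0 {ℕ.zero}  A = refl
  sumProd-0 {ℕ.suc n} A = sumL-all≈0 (A zero) (All.tabulate (λ _ → sumProd-0 (tail A)))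

  sumProd-+ : ∀ {n} (A : Fin n → List Carrier) (g h : Vector Carrier n → Carrier) →
              sumProd A (λ v → g v + h v) ≈ sumProd A g + sumProd A h
  sumProd-+ {ℕ.zero}  A g h = refl
  sumProd-+ {ℕ.suc n} A g h =
    trans (sumL-cong (A zero) (λ a → sumProd-+ (tail A) _ _)) (sumL-+ (A zero) _ _)

  sumProd-*ˡ : ∀ {n} (A : Fin n → List Carrier) (k : Carrier) (g : Vector Carrier n → Carrier) →
               sumProd A (λ v → k * g v) ≈ k * sumProd A g
  sumProd-*ˡ {ℕ.zero}  A k g = refl
  sumProd-*ˡ {ℕ.suc n} A k g =
    trans (sumL-cong (A zero) (λ a → sumProd-*ˡ (tail A) k _)) (sumL-*ˡ (A zero) k _)

  sumProd-prodF : ∀ {n} (A : Fin n → List Carrier) (g : Fin n → Carrier → Carrier) →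
                  sumProd A (λ v → prodF (λ i → g i (v i))) ≈ prodF (λ i → sumL (map (g i) (A i)))
  sumProd-prodF {ℕ.zero}  A g = refl
  sumProd-prodF {ℕ.suc n} A g = begin
    sumL (map (λ a → sumProd (tail A) (λ v → g zero a * prodF (λ i → g (suc i) (v i)))) (A zero))
      ≈⟨ sumL-cong (A zero) (λ a → sumProd-*ˡ (tail A) (g zero a) _) ⟩
    sumL (map (λ a → g zero a * sumProd (tail A) (λ v → prodF (λ i → g (suc i) (v i)))) (A zero))
      ≈⟨ sumL-*ʳ (A zero) _ (g zero) ⟩
    sumL (map (g zero) (A zero)) * sumProd (tail A) (λ v → prodF (λ i → g (suc i) (v i)))
      ≈⟨ *-cong refl (sumProd-prodF (tail A) (λ i → g (suc i))) ⟩
    sumL (map (g zero) (A zero)) * prodF (λ i → sumL (map (g (suc i)) (A (suc i))))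
      ∎

  prodF-≈0 : ∀ {n} (g : Fin n → Carrier) (i : Fin n) → g i ≈ 0# → prodF g ≈ 0#
  prodF-≈0 g zero    gi≈0 = trans (*-cong gi≈0 refl) (zeroˡ _)
  prodF-≈0 g (suc i) gi≈0 = trans (*-cong refl (prodF-≈0 (λ j → g (suc j)) i gi≈0)) (zeroʳ _)

  sumProd-eval : ∀ {n} (A : Fin n → List Carrier) (f : Poly n) →
                 sumProd A (eval f) ≈ sumL (map (λ t → sumProd A (evalTerm t)) f)
  sumProd-eval A []      = sumProd-0 A
  sumProd-eval A (t ∷ f) = trans (sumProd-+ A _ _) (+-cong refl (sumProd-eval A f))

  sumProd-evalTerm : ∀ {n} (A : Fin n → List Carrier) (k : Carrier) (e : Fin n → ℕ.ℕ) →
                     sumProd A (evalTerm (k , e)) ≈ k * prodF (λ i → powerSum (A i) (e i))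
  sumProd-evalTerm A k e =
    trans (sumProd-*ˡ A k _) (*-cong refl (sumProd-prodF A (λ i a → a ^ e i)))

  monoDeg<⇒∃exponent≤ : ∀ {n} (l : ℕ.ℕ) (e : Fin n → ℕ.ℕ) →
                        monoDeg e ℕ.< n ℕ.* (l ℕ.+ 1) → ∃ λ i → e i ℕ.≤ l
  monoDeg<⇒∃exponent≤ {ℕ.zero}  l e ()
  monoDeg<⇒∃exponent≤ {ℕ.suc n} l e deg< with e zero ℕ.≤? l
  ... | yes e₀≤l = zero , e₀≤l
  ... | no  e₀≰l with monoDeg<⇒∃exponent≤ l (λ i → e (suc i)) tail-deg<
    where
    l+1≤e₀ : l ℕ.+ 1 ℕ.≤ e zero
    l+1≤e₀ = ℕ.≤-trans (ℕ.≤-reflexive (ℕ.+-comm l 1)) (ℕ.≰⇒> e₀≰l)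
    tail-deg< : monoDeg (λ i → e (suc i)) ℕ.< n ℕ.* (l ℕ.+ 1)
    tail-deg< = ℕ.+-cancelˡ-< (l ℕ.+ 1) _ _ (ℕ.≤-<-trans (ℕ.+-monoˡ-≤ _ l+1≤e₀) deg<)
  ... | i , eᵢ≤l = suc i , eᵢ≤l

  sumProd-eval≈0 : ∀ {n} (l : ℕ.ℕ) (A : Fin n → List Carrier) →
                   (∀ i r → r ℕ.≤ l → powerSum (A i) r ≈ 0#) →
                   (f : Poly n) → DegLt f (n ℕ.* (l ℕ.+ 1)) → sumProd A (eval f) ≈ 0#
  sumProd-eval≈0 l A lowPowerSums≈0 f deg< =
    trans (sumProd-eval A f) (sumL-all≈0 f (All.map term≈0 deg<))
    where
    term≈0 : ∀ {t} → monoDeg (proj₂ t) ℕ.< _ → sumProd A (evalTerm t) ≈ 0#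
    term≈0 {k , e} deg-e< with monoDeg<⇒∃exponent≤ l e deg-e<
    ... | i , eᵢ≤l = begin
      sumProd A (evalTerm (k , e))               ≈⟨ sumProd-evalTerm A k e ⟩
      k * prodF (λ j → powerSum (A j) (e j))     ≈⟨ *-cong refl (prodF-≈0 _ i (lowPowerSums≈0 i (e i) eᵢ≤l)) ⟩
      k * 0#                                     ≈⟨ zeroʳ k ⟩
      0#                                         ∎

  fromℕ-+ : ∀ a b → fromℕ (a ℕ.+ b) ≈ fromℕ a + fromℕ b
  fromℕ-+ ℕ.zero    b = sym (+-identityˡ _)
  fromℕ-+ (ℕ.suc a) b = trans (+-cong refl (fromℕ-+ a b)) (sym (+-assoc _ _ _))

  fromℕ-∣-≈0 : ∀ {p m} → p ∣ m → fromℕ p ≈ 0# → fromℕ m ≈ 0#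
  fromℕ-∣-≈0 {p} (divides q ≡.refl) p≈0 = multiple≈0 q
    where
    multiple≈0 : ∀ q → fromℕ (q ℕ.* p) ≈ 0#
    multiple≈0 ℕ.zero    = refl
    multiple≈0 (ℕ.suc q) =
      trans (fromℕ-+ p (q ℕ.* p)) (trans (+-cong p≈0 (multiple≈0 q)) (+-identityˡ 0#))

  powerSum-0 : (A : List Carrier) → powerSum A 0 ≈ fromℕ (length A)
  powerSum-0 []      = refl
  powerSum-0 (a ∷ A) = +-cong refl (powerSum-0 A)

  vandermonde-powerSum≈0 : ∀ {l} (A : List Carrier) → IsVandermonde l A →
                           fromℕ (length A) ≈ 0# → ∀ r → r ℕ.≤ l → powerSum A r ≈ 0#
  vandermonde-powerSum≈0 A _         |A|≈0 ℕ.zero    _   = trans (powerSum-0 A) |A|≈0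
  vandermonde-powerSum≈0 A (_ , V≈0) _     (ℕ.suc r) r≤l = V≈0 (ℕ.suc r) (ℕ.s≤s ℕ.z≤n) r≤l

open import Data.Nat using (ℕ; _*_; _+_)

theorem5p5 : {c ℓ : Level} (F : Field c ℓ) →
    let open FieldNotions F in (p : ℕ) → HasCharacteristic p → (λ' n : ℕ) → (A : Fin n → List Carrier) →
    (∀ i → IsFiniteNonemptySubset (A i)) →
    (∀ i → IsVandermonde λ' (A i)) →
    (∀ i → p ∣ length (A i)) →
    (f : Poly n) → DegLt f (n * (λ' + 1)) →
    sumProd A (eval f) ≈ 0#
theorem5p5 F p (_ , p≈0 , _) λ' n A _ vandermonde p∣|A| =
  sumProd-eval≈0 λ' A (λ i → vandermonde-powerSum≈0 (A i) (vandermonde i) (fromℕ-∣-≈0 (p∣|A| i) p≈0))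
  where open BoxSums F
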